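{- Let $G$ be a graph with $V(G)=\{x_1,\ldots,x_n\}$, and let $G'$ be the graph with $V(G')=V(G)\cup\{x,y,z\}$ (where $x,y,z$ are new vertices) and $E(G')=E(G)\cup\{xz,zy\}\cup\{zx_i:\ i\in[n]\}$. A set $\Psi$ of vertex-disjoint induced paths on $3$ vertices in $G$ is an induced $P_3$-packing of $G$ if and only if $\Psi\cup\{xzy\}$ is a geodesic packing of $G'$.
   Context: An induced $P_3$-packing of $G$ is a set of pairwise vertex-disjoint induced paths on $3$ vertices in $G$. A geodesic is a shortest path; it is maximal if it is not contained as a subpath in any other geodesic. A geodesic packing of a graph is a set of pairwise vertex-disjoint maximal geodesics. $xzy$ denotes the path with consecutive vertices $x,z,y$. -}

module Defs where

open import Data.Nat using (ℕ; _≤_)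
open import Data.List using (List; []; _∷_; length; head; last)
open import Data.Maybe using (Maybe)
open import Data.Empty using (⊥)
open import Data.Unit using (⊤)
open import Data.Product using (_×_; Σ-syntax)
open import Relation.Nullary using (¬_)
open import Relation.Binary.PropositionalEquality using (_≡_; _≢_)
open import Data.List.Relation.Unary.All using (All)
open import Data.List.Relation.Unary.AllPairs using (AllPairs)
open import Data.List.Relation.Unary.Linked using (Linked)
open import Data.List.Relation.Unary.Unique.Propositional using (Unique)
open import Data.List.Relation.Binary.Infix.Heterogeneous using (Infix)
open import Data.List.Membership.Propositional using (_∈_; _∉_)

record Graph (V : Set) : Set₁ where
  field
    Adj    : V → V → Set
    sym    : ∀ {u v} → Adj u v → Adj v u
    irrefl : ∀ {v} → ¬ Adj v v
open Graph public

module _ {V : Set} (G : Graph V) where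

  -- A path: a nonempty list of distinct vertices, consecutive ones adjacent.
  -- Its length (number of edges) is (length p ∸ 1), so comparing list
  -- lengths compares path lengths.
  IsPath : List V → Set
  IsPath p = (p ≢ []) × Linked (Adj G) p × Unique p

  IsGeodesic : List V → Set
  IsGeodesic p = IsPath p ×
    (∀ q → IsPath q → head q ≡ head p → last q ≡ last p → length p ≤ length q)

  -- Maximal geodesic: not a subpath of any other (longer) geodesic.
  -- (Containment in reversed orientation is covered since the reverse of
  -- a geodesic is a geodesic.)
  IsMaximalGeodesic : List V → Set
  IsMaximalGeodesic p = IsGeodesic p ×
    (∀ q → IsGeodesic q → Infix _≡_ p q → length q ≤ length p)

  IsP3 : List V → Set
  IsP3 p = Σ[ a ∈ V ] Σ[ b ∈ V ] Σ[ c ∈ V ]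
    (p ≡ a ∷ b ∷ c ∷ []) × Adj G a b × Adj G b c × a ≢ c

  IsInducedP3 : List V → Set
  IsInducedP3 p = Σ[ a ∈ V ] Σ[ b ∈ V ] Σ[ c ∈ V ]
    (p ≡ a ∷ b ∷ c ∷ []) × Adj G a b × Adj G b c × a ≢ c × ¬ Adj G a c

Disjoint : {V : Set} → List V → List V → Set
Disjoint p q = ∀ v → v ∈ p → v ∉ q

InducedP3Packing : {V : Set} → Graph V → List (List V) → Set
InducedP3Packing G Ψ = All (IsInducedP3 G) Ψ × AllPairs Disjoint Ψ

GeodesicPacking : {V : Set} → Graph V → List (List V) → Set
GeodesicPacking G Φ = All (IsMaximalGeodesic G) Φ × AllPairs Disjoint Φ

data Ext (V : Set) : Set where
  old : V → Ext V
  vx vy vz : Ext V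

ExtAdj : {V : Set} → Graph V → Ext V → Ext V → Set
ExtAdj G (old u) (old v) = Adj G u v
ExtAdj G (old u) vz = ⊤
ExtAdj G vz (old v) = ⊤
ExtAdj G vx vz = ⊤
ExtAdj G vz vx = ⊤
ExtAdj G vy vz = ⊤
ExtAdj G vz vy = ⊤
ExtAdj G _ _ = ⊥

ExtAdj-sym : {V : Set} (G : Graph V) → ∀ {u v} → ExtAdj G u v → ExtAdj G v u
ExtAdj-sym G {old u} {old v} e = sym G e
ExtAdj-sym G {old u} {vz} e = e
ExtAdj-sym G {vz} {old v} e = e
ExtAdj-sym G {vx} {vz} e = e
ExtAdj-sym G {vz} {vx} e = e
ExtAdj-sym G {vy} {vz} e = e
ExtAdj-sym G {vz} {vy} e = e
ExtAdj-sym G {old u} {vx} ()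
ExtAdj-sym G {old u} {vy} ()
ExtAdj-sym G {vx} {old v} ()
ExtAdj-sym G {vx} {vx} ()
ExtAdj-sym G {vx} {vy} ()
ExtAdj-sym G {vy} {old v} ()
ExtAdj-sym G {vy} {vx} ()
ExtAdj-sym G {vy} {vy} ()
ExtAdj-sym G {vz} {vz} ()

ExtAdj-irrefl : {V : Set} (G : Graph V) → ∀ {v} → ¬ ExtAdj G v v
ExtAdj-irrefl G {old v} e = irrefl G e
ExtAdj-irrefl G {vx} ()
ExtAdj-irrefl G {vy} ()
ExtAdj-irrefl G {vz} ()

extend : {V : Set} → Graph V → Graph (Ext V)
extend G = record { Adj = ExtAdj G ; sym = λ {u} {v} → ExtAdj-sym G {u} {v} ; irrefl = λ {v} → ExtAdj-irrefl G {v} }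

-- In G' the vertex z is adjacent to every other vertex, so any two vertices are joined by a
-- path on at most three vertices and no geodesic of G' has more than three vertices. Hence a
-- path abc of G' is a maximal geodesic exactly when it is a geodesic, i.e. when a and c are
-- not adjacent. Since the old vertices induce G in G', and xzy avoids them, both the
-- induced-P3 condition and disjointness transfer between Ψ and its copy in G'.
module Submission where

open import Defs
open import Data.Fin using (Fin)
open import Data.List using (List; []; _∷_; map; _++_; length; head; last)
open import Data.List.Relation.Unary.All using (All; []; _∷_)
open import Function.Bundles using (_⇔_; mk⇔)
open import Function.Base using (_∘_)
open import Function.Definitions using (Injective)
open import Data.Nat using (_≤_; z≤n; s≤s)
open import Data.Nat.Properties using (≤-trans)
open import Data.Maybe using (just)
open import Data.Product using (_×_; _,_; Σ-syntax)
open import Data.Empty using (⊥-elim)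
open import Data.Unit using (tt)
open import Relation.Nullary using (¬_; Dec; yes; no)
open import Relation.Binary.PropositionalEquality
  using (_≡_; _≢_; refl; trans) renaming (sym to ≡-sym)
open import Data.List.Relation.Unary.AllPairs using (AllPairs; []; _∷_)
open import Data.List.Relation.Unary.Linked using ([-]; _∷_)
open import Data.List.Relation.Unary.Any using (here; there)
open import Data.List.Membership.Propositional using (_∈_)
open import Data.List.Membership.Propositional.Properties using (∈-map⁺; ∈-map⁻)
import Data.List.Relation.Unary.All as All
import Data.List.Relation.Unary.All.Properties as All
import Data.List.Relation.Unary.AllPairs as AllPairs
import Data.List.Relation.Unary.AllPairs.Properties as AllPairs

last-∈ : {A : Set} (x : A) (xs : List A) → Σ[ t ∈ A ] (last (x ∷ xs) ≡ just t × t ∈ x ∷ xs)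
last-∈ x [] = x , refl , here refl
last-∈ x (y ∷ ys) with last-∈ y ys
... | t , last≡t , t∈ = t , last≡t , there t∈

AllPairs-++⁻ˡ : {A : Set} {R : A → A → Set} (xs : List A) {ys : List A} →
                AllPairs R (xs ++ ys) → AllPairs R xs
AllPairs-++⁻ˡ []       _          = []
AllPairs-++⁻ˡ (x ∷ xs) (px ∷ pxs) = All.++⁻ˡ xs px ∷ AllPairs-++⁻ˡ xs pxs

module _ {A B : Set} (f : A → B) where

  Disjoint-map⁺ : Injective _≡_ _≡_ f → ∀ {p q} → Disjoint p q → Disjoint (map f p) (map f q)
  Disjoint-map⁺ f-inj d v v∈fp v∈fq with ∈-map⁻ f v∈fp | ∈-map⁻ f v∈fq
  ... | a , a∈p , refl | b , b∈q , fa≡fb with f-inj fa≡fb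
  ... | refl = d a a∈p b∈q

  Disjoint-map⁻ : ∀ {p q} → Disjoint (map f p) (map f q) → Disjoint p q
  Disjoint-map⁻ d v v∈p v∈q = d (f v) (∈-map⁺ f v∈p) (∈-map⁺ f v∈q)

module _ {V : Set} (G : Graph V) where

  Adj⇒≢ : ∀ {u v} → Adj G u v → u ≢ v
  Adj⇒≢ uv refl = irrefl G uv

  inducedP3⇒geodesic : ∀ {p} → IsInducedP3 G p → IsGeodesic G p
  inducedP3⇒geodesic (a , b , c , refl , ab , bc , a≢c , ¬ac) = path , shortest
    where
    path : IsPath G (a ∷ b ∷ c ∷ [])
    path = (λ ()) , ab ∷ bc ∷ [-] , (Adj⇒≢ ab ∷ a≢c ∷ []) ∷ (Adj⇒≢ bc ∷ []) ∷ [] ∷ []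

    shortest : ∀ q → IsPath G q → head q ≡ just a → last q ≡ just c → 3 ≤ length q
    shortest []                _                    ()   _
    shortest (_ ∷ [])          _                    refl refl = ⊥-elim (a≢c refl)
    shortest (_ ∷ _ ∷ [])      (_ , (ac ∷ _) , _)   refl refl = ⊥-elim (¬ac ac)
    shortest (_ ∷ _ ∷ _ ∷ _)   _                    _    _    = s≤s (s≤s (s≤s z≤n))

  geodesicP3⇒inducedP3 : ∀ {p} → IsP3 G p → IsGeodesic G p → IsInducedP3 G p
  geodesicP3⇒inducedP3 (a , b , c , refl , ab , bc , a≢c) (_ , shortest) =
    a , b , c , refl , ab , bc , a≢c , ¬ac
    where
    ¬ac : ¬ Adj G a c
    ¬ac ac with shortest (a ∷ c ∷ []) ((λ ()) , ac ∷ [-] , (Adj⇒≢ ac ∷ []) ∷ [] ∷ []) refl refl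
    ... | s≤s (s≤s ())

  module UniversalVertex (w : V) (_≟w : ∀ v → Dec (v ≡ w))
                         (w-adj : ∀ {v} → v ≢ w → Adj G w v) where

    path-via-w : ∀ u v → u ≢ v →
      Σ[ q ∈ List V ] (IsPath G q × head q ≡ just u × last q ≡ just v × length q ≤ 3)
    path-via-w u v u≢v with u ≟w | v ≟w
    ... | yes refl | _ =
      (w ∷ v ∷ []) , ((λ ()) , w-adj (u≢v ∘ ≡-sym) ∷ [-] , (u≢v ∷ []) ∷ [] ∷ []) ,
      refl , refl , s≤s (s≤s z≤n)
    ... | no u≢w | yes refl =
      (u ∷ w ∷ []) , ((λ ()) , sym G (w-adj u≢w) ∷ [-] , (u≢v ∷ []) ∷ [] ∷ []) ,
      refl , refl , s≤s (s≤s z≤n)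
    ... | no u≢w | no v≢w =
      (u ∷ w ∷ v ∷ []) ,
      ((λ ()) , sym G (w-adj u≢w) ∷ w-adj v≢w ∷ [-] ,
        (u≢w ∷ u≢v ∷ []) ∷ ((v≢w ∘ ≡-sym) ∷ []) ∷ [] ∷ []) ,
      refl , refl , s≤s (s≤s (s≤s z≤n))

    geodesic-length≤3 : ∀ p → IsGeodesic G p → length p ≤ 3
    geodesic-length≤3 []                    _ = z≤n
    geodesic-length≤3 (_ ∷ [])              _ = s≤s z≤n
    geodesic-length≤3 (_ ∷ _ ∷ [])          _ = s≤s (s≤s z≤n)
    geodesic-length≤3 (_ ∷ _ ∷ _ ∷ [])      _ = s≤s (s≤s (s≤s z≤n))
    geodesic-length≤3 (u ∷ v ∷ x ∷ y ∷ rest) ((_ , _ , u≢tail ∷ _) , shortest)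
      with last-∈ v (x ∷ y ∷ rest)
    ... | t , last≡t , t∈ with path-via-w u t (All.lookup u≢tail t∈)
    ... | q , q-path , head-q , last-q , |q|≤3
      with ≤-trans (shortest q q-path head-q (trans last-q (≡-sym last≡t))) |q|≤3
    ... | s≤s (s≤s (s≤s ()))

    inducedP3⇒maximalGeodesic : ∀ {p} → IsInducedP3 G p → IsMaximalGeodesic G p
    inducedP3⇒maximalGeodesic ind@(_ , _ , _ , refl , _) =
      inducedP3⇒geodesic ind , λ q q-geo _ → geodesic-length≤3 q q-geo

module _ {V : Set} where

  old-injective : Injective _≡_ _≡_ (old {V})
  old-injective refl = refl

  _≟vz : (v : Ext V) → Dec (v ≡ vz)
  old _ ≟vz = no λ ()
  vx    ≟vz = no λ ()
  vy    ≟vz = no λ ()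
  vz    ≟vz = yes refl

  old-disjoint-xzy : ∀ (p : List V) → Disjoint (map old p) (vx ∷ vz ∷ vy ∷ [])
  old-disjoint-xzy p v v∈p v∈xzy with ∈-map⁻ old v∈p
  old-disjoint-xzy p v v∈p (here ())                 | _ , _ , refl
  old-disjoint-xzy p v v∈p (there (here ()))         | _ , _ , refl
  old-disjoint-xzy p v v∈p (there (there (here ()))) | _ , _ , refl

module _ {V : Set} (G : Graph V) where

  vz-adj : ∀ {v} → v ≢ vz → ExtAdj G vz v
  vz-adj {old _} _    = tt
  vz-adj {vx}    _    = tt
  vz-adj {vy}    _    = tt
  vz-adj {vz}    v≢vz = ⊥-elim (v≢vz refl)

  open UniversalVertex (extend G) vz _≟vz vz-adj

  xzy-maximalGeodesic : IsMaximalGeodesic (extend G) (vx ∷ vz ∷ vy ∷ [])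
  xzy-maximalGeodesic = inducedP3⇒maximalGeodesic (vx , vz , vy , refl , tt , tt , (λ ()) , λ ())

  inducedP3⇒old-maximalGeodesic : ∀ {p} → IsInducedP3 G p → IsMaximalGeodesic (extend G) (map old p)
  inducedP3⇒old-maximalGeodesic (a , b , c , refl , ab , bc , a≢c , ¬ac) =
    inducedP3⇒maximalGeodesic
      (old a , old b , old c , refl , ab , bc , a≢c ∘ old-injective , ¬ac)

  old-maximalGeodesic⇒inducedP3 : ∀ {p} → IsP3 G p → IsMaximalGeodesic (extend G) (map old p) →
                                  IsInducedP3 G p
  old-maximalGeodesic⇒inducedP3 (a , b , c , refl , ab , bc , a≢c) (geo , _) =
    let (_ , _ , _ , _ , _ , _ , _ , ¬ac) =
          geodesicP3⇒inducedP3 (extend G)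
            (old a , old b , old c , refl , ab , bc , a≢c ∘ old-injective) geo
    in a , b , c , refl , ab , bc , a≢c , ¬ac

lemma2p1 : ∀ {n} (G : Graph (Fin n)) (Ψ : List (List (Fin n))) →
    All (IsP3 G) Ψ →
    InducedP3Packing G Ψ ⇔ GeodesicPacking (extend G) (map (map old) Ψ ++ (vx ∷ vz ∷ vy ∷ []) ∷ [])
lemma2p1 G Ψ P3s = mk⇔ packing⇒geodesicPacking geodesicPacking⇒packing
  where
  packing⇒geodesicPacking : InducedP3Packing G Ψ →
    GeodesicPacking (extend G) (map (map old) Ψ ++ (vx ∷ vz ∷ vy ∷ []) ∷ [])
  packing⇒geodesicPacking (induced , disjoint) =
    All.++⁺ (All.map⁺ (All.map (inducedP3⇒old-maximalGeodesic G) induced))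
            (xzy-maximalGeodesic G ∷ []) ,
    AllPairs.++⁺ (AllPairs.map⁺ (AllPairs.map (Disjoint-map⁺ old old-injective) disjoint))
                 ([] ∷ [])
                 (All.map⁺ (All.universal (λ p → old-disjoint-xzy p ∷ []) Ψ))

  geodesicPacking⇒packing :
    GeodesicPacking (extend G) (map (map old) Ψ ++ (vx ∷ vz ∷ vy ∷ []) ∷ []) →
    InducedP3Packing G Ψ
  geodesicPacking⇒packing (maximal , disjoint) =
    All.zipWith (λ (P3 , geo) → old-maximalGeodesic⇒inducedP3 G P3 geo)
      (P3s , All.map⁻ (All.++⁻ˡ (map (map old) Ψ) maximal)) ,
    AllPairs.map (Disjoint-map⁻ old)
      (AllPairs.map⁻ (AllPairs-++⁻ˡ (map (map old) Ψ) disjoint))
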